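{- For each $n\ge0$ and $e\in\mathbf{I}_n(\underline{01}1)$, assign the label $L(e)=(a,b)=(|A_{>}(e)|,|B_{\le}(e)|)$. Then the empty sequence has label $(0,1)$, and if $e\in\mathbf{I}_n(\underline{01}1)$ has label $(a,b)$, then the multiset of labels $\{L(eh): h\text{ an active site of } e\}$ equals the multiset consisting of $(a+1-i,\,b-1+i)$ for $i=1,\dots,a$ together with $(a+b+1-i,\,i)$ for $i=1,\dots,b$; that is, $(a,b),(a-1,b+1),\dots,(1,b+a-1),(a+b,1),(a+b-1,2),\dots,(a+1,b)$.
   Context: $\mathbf{I}_n$ is the set of integer sequences $e_1\dots e_n$ with $0\le e_i<i$; $\mathbf{I}_n(\underline{01}1)$ is the set of $e\in\mathbf{I}_n$ with no positions $i,k$, $i+1<k$, with $e_i<e_{i+1}=e_k$. For $e\in\mathbf{I}_n(\underline{01}1)$, an active site is a value $h\in\{0,\dots,n\}$ with $eh=e_1\dots e_nh\in\mathbf{I}_{n+1}(\underline{01}1)$. With the convention $e_0=0$ (used when $n=0$), $A_{>}(e)$ is the set of active sites $h$ with $h>e_n$ and $B_{\le}(e)$ the set of active sites $h$ with $h\le e_n$. -}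

module Defs where

open import Data.Nat using (ℕ; zero; suc; _+_; _∸_; _<_; _≤_; _<?_; _≤?_; _≟_)
open import Data.Fin using (Fin; toℕ)
open import Data.Fin.Properties using (all?; any?)
open import Data.Vec using (Vec; []; _∷_; lookup; _∷ʳ_)
open import Data.List using (List; filter; length; map; upTo; applyUpTo; _++_)
open import Data.Product using (Σ; _×_; _,_)
open import Data.Product.Relation.Binary.Pointwise.NonDependent using ()
open import Relation.Nullary using (¬_; Dec; yes; no)
open import Relation.Nullary.Decidable using (_×-dec_; ¬?)
open import Relation.Binary.PropositionalEquality using (_≡_)

-- Inversion sequences, stored 0-indexed: position j (0-based) holds e_{j+1},
-- so the condition 0 ≤ e_{j+1} < j+1 reads  lookup e j < suc (toℕ j).
IsInv : ∀ {n} → Vec ℕ n → Set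
IsInv {n} e = (j : Fin n) → lookup e j < suc (toℕ j)

Occ011 : ∀ {n} → Vec ℕ n → Set
Occ011 {n} e =
  Σ (Fin n) λ i → Σ (Fin n) λ j → Σ (Fin n) λ k →
    (toℕ j ≡ suc (toℕ i)) × (toℕ j < toℕ k) ×
    (lookup e i < lookup e j) × (lookup e j ≡ lookup e k)

InI011 : ∀ {n} → Vec ℕ n → Set
InI011 e = IsInv e × ¬ Occ011 e

isInv? : ∀ {n} (e : Vec ℕ n) → Dec (IsInv e)
isInv? e = all? (λ j → lookup e j <? suc (toℕ j))

occ011? : ∀ {n} (e : Vec ℕ n) → Dec (Occ011 e)
occ011? e = any? λ i → any? λ j → any? λ k →
  (toℕ j ≟ suc (toℕ i)) ×-dec (toℕ j <? toℕ k) ×-dec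
  (lookup e i <? lookup e j) ×-dec (lookup e j ≟ lookup e k)

inI011? : ∀ {n} (e : Vec ℕ n) → Dec (InI011 e)
inI011? e = isInv? e ×-dec ¬? (occ011? e)

IsActive : ∀ {n} → Vec ℕ n → ℕ → Set
IsActive {n} e h = (h ≤ n) × InI011 (e ∷ʳ h)

isActive? : ∀ {n} (e : Vec ℕ n) (h : ℕ) → Dec (IsActive e h)
isActive? {n} e h = (h ≤? n) ×-dec inI011? (e ∷ʳ h)

activeSites : ∀ {n} → Vec ℕ n → List ℕ
activeSites {n} e = filter (isActive? e) (upTo (suc n))

-- last entry e_n, with the convention e_0 = 0 for the empty sequence
lastOr0 : ∀ {n} → Vec ℕ n → ℕ
lastOr0 []           = 0
lastOr0 (x ∷ [])     = x
lastOr0 (x ∷ y ∷ xs) = lastOr0 (y ∷ xs)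

A> : ∀ {n} → Vec ℕ n → List ℕ
A> e = filter (λ h → lastOr0 e <? h) (activeSites e)

B≤ : ∀ {n} → Vec ℕ n → List ℕ
B≤ e = filter (λ h → h ≤? lastOr0 e) (activeSites e)

label : ∀ {n} → Vec ℕ n → ℕ × ℕ
label e = length (A> e) , length (B≤ e)

childLabels : ∀ {n} → Vec ℕ n → List (ℕ × ℕ)
childLabels e = map (λ h → label (e ∷ʳ h)) (activeSites e)

-- (a+1-i, b-1+i) for i = 1..a, followed by (a+b+1-i, i) for i = 1..b
-- (applyUpTo suc a = [1, …, a]; for i ≥ 1, b + i ∸ 1 = b - 1 + i)
successorLabels : ℕ × ℕ → List (ℕ × ℕ)
successorLabels (a , b) =
  map (λ i → (a + 1 ∸ i , b + i ∸ 1)) (applyUpTo suc a) ++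
  map (λ i → (a + b + 1 ∸ i , i)) (applyUpTo suc b)

module Submission where

-- Write ℓ = e_n and S = s₁ < … < s_m for the (increasing) active sites of e.
--  * For e ∈ I_n(01̲1), a value y ≤ n is an active site iff y is not the top
--    of an ascent e_i < e_{i+1} = y, and n itself is always active.
--  * Appending an active site h creates at most one new ascent top, namely h
--    itself when ℓ < h.  So the active sites of e h are the sites y ∈ S that
--    survive h (not ℓ < h = y), followed by the new site n+1, and L(e h) is
--    a function childLabel ℓ S h of ℓ, S and h alone.
--  * For any increasing list S, listing childLabel ℓ S along S gives the b
--    labels (a+b,1),…,(a+1,b) followed by the a labels (a,b),…,(1,a+b-1),
--    where (a, b) counts the sites above / at most ℓ.  This is an induction
--    on S: removing the smallest site shifts every other label by (0,+1).

open import Defs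
open import Data.Nat using (ℕ; zero; suc; _+_; _∸_; _<_; _≤_; _<?_; _≤?_; _≟_; s≤s; s≤s⁻¹)
open import Data.Nat.Properties
open import Data.Fin using (Fin; toℕ; inject₁; fromℕ) renaming (zero to fzero; suc to fsuc)
open import Data.Fin.Properties using (toℕ-inject₁; toℕ-fromℕ; toℕ<n; inject₁ℕ<)
open import Data.Fin.Relation.Unary.Top using (view; ‵fromℕ; ‵inject₁)
open import Data.Vec using (Vec; []; _∷_; lookup; _∷ʳ_)
open import Data.List using (List; []; _∷_; [_]; filter; length; map; upTo; applyUpTo; _++_)
open import Data.List.Properties using (filter-accept; filter-reject; filter-all; filter-++; map-++; map-∘; map-cong; map-cong-local; map-upTo; map-applyUpTo; upTo-∷ʳ)
open import Data.List.Relation.Unary.All using (All; []; _∷_)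
import Data.List.Relation.Unary.All as All
open import Data.List.Relation.Unary.All.Properties using (all-filter; applyUpTo⁺₁)
open import Data.List.Relation.Unary.AllPairs using (AllPairs; []; _∷_)
import Data.List.Relation.Unary.AllPairs.Properties as AllPairs
open import Data.List.Relation.Binary.Permutation.Propositional using (_↭_; ↭-reflexive; ↭-trans)
open import Data.List.Relation.Binary.Permutation.Propositional.Properties using (++-comm)
open import Data.Product using (Σ; _×_; _,_; proj₁; proj₂; map₁; map₂)
open import Data.Sum using (_⊎_; inj₁; inj₂; [_,_]′)
open import Data.Empty using (⊥-elim)
open import Function using (_∘_; id)
open import Level using (0ℓ)
open import Relation.Nullary using (¬_; Dec; yes; no)
open import Relation.Unary using (Pred; Decidable)
open import Relation.Nullary.Decidable using (_×-dec_; ¬?)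
open import Relation.Binary.PropositionalEquality hiding ([_])
open ≡-Reasoning

labelAt : ℕ → List ℕ → ℕ × ℕ
labelAt ℓ T = length (filter (ℓ <?_) T) , length (filter (_≤? ℓ) T)

labelAt-∷-above : ∀ {ℓ x} T → ℓ < x → labelAt ℓ (x ∷ T) ≡ map₁ suc (labelAt ℓ T)
labelAt-∷-above {ℓ} {x} T ℓ<x
  rewrite filter-accept (ℓ <?_) {x} {T} ℓ<x | filter-reject (_≤? ℓ) {x} {T} (<⇒≱ ℓ<x) = refl

labelAt-∷-atMost : ∀ {ℓ x} T → x ≤ ℓ → labelAt ℓ (x ∷ T) ≡ map₂ suc (labelAt ℓ T)
labelAt-∷-atMost {ℓ} {x} T x≤ℓ
  rewrite filter-reject (ℓ <?_) {x} {T} (≤⇒≯ x≤ℓ) | filter-accept (_≤? ℓ) {x} {T} x≤ℓ = refl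

total : ℕ × ℕ → ℕ
total (a , b) = a + b

labelAt-total : ∀ ℓ T → total (labelAt ℓ T) ≡ length T
labelAt-total ℓ [] = refl
labelAt-total ℓ (x ∷ T) with <-≤-connex ℓ x
... | inj₁ ℓ<x = trans (cong total (labelAt-∷-above T ℓ<x)) (cong suc (labelAt-total ℓ T))
... | inj₂ x≤ℓ = trans (cong total (labelAt-∷-atMost T x≤ℓ))
  (trans (+-suc _ _) (cong suc (labelAt-total ℓ T)))

labelAt-allAbove : ∀ {ℓ} T → All (ℓ <_) T → labelAt ℓ T ≡ (length T , 0)
labelAt-allAbove [] [] = refl
labelAt-allAbove (x ∷ T) (ℓ<x ∷ above) =
  trans (labelAt-∷-above T ℓ<x) (cong (map₁ suc) (labelAt-allAbove T above))

labelAt-∷ʳ-above : ∀ {ℓ t} T → ℓ < t → labelAt ℓ (T ++ [ t ]) ≡ map₁ suc (labelAt ℓ T)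
labelAt-∷ʳ-above [] ℓ<t = labelAt-∷-above [] ℓ<t
labelAt-∷ʳ-above {ℓ} (x ∷ T) ℓ<t with <-≤-connex ℓ x
... | inj₁ ℓ<x = trans (labelAt-∷-above (T ++ _) ℓ<x)
  (trans (cong (map₁ suc) (labelAt-∷ʳ-above T ℓ<t)) (cong (map₁ suc) (sym (labelAt-∷-above T ℓ<x))))
... | inj₂ x≤ℓ = trans (labelAt-∷-atMost (T ++ _) x≤ℓ)
  (trans (cong (map₂ suc) (labelAt-∷ʳ-above T ℓ<t)) (cong (map₁ suc) (sym (labelAt-∷-atMost T x≤ℓ))))

-- Appending h to e (with e_n = ℓ) keeps the old site y active unless h
-- creates an ascent e_n < h whose top y = h thereby becomes forbidden.
Survives : ℕ → ℕ → ℕ → Set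
Survives ℓ h y = ¬ (ℓ < h × y ≡ h)

survives? : ∀ ℓ h y → Dec (Survives ℓ h y)
survives? ℓ h y = ¬? ((ℓ <? h) ×-dec (y ≟ h))

-- The label of e h in terms of ℓ = e_n and the sites S of e: the surviving
-- sites are counted relative to h, and the new site n+1 lies above h.
childLabel : ℕ → List ℕ → ℕ → ℕ × ℕ
childLabel ℓ S h = map₁ suc (labelAt h (filter (survives? ℓ h) S))

childLabel-∷-below : ∀ ℓ {x h} S → x < h → childLabel ℓ (x ∷ S) h ≡ map₂ suc (childLabel ℓ S h)
childLabel-∷-below ℓ {x} {h} S x<h
  rewrite filter-accept (survives? ℓ h) {x} {S} (λ (_ , x≡h) → <⇒≢ x<h x≡h) =
  cong (map₁ suc) (labelAt-∷-atMost _ (<⇒≤ x<h))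

childLabels-∷-below : ∀ ℓ {x} S → All (x <_) S →
  map (childLabel ℓ (x ∷ S)) S ≡ map (map₂ suc) (map (childLabel ℓ S) S)
childLabels-∷-below ℓ S x<S = trans (map-cong-local (All.map (childLabel-∷-below ℓ S) x<S)) (map-∘ S)

survivors-above : ∀ ℓ {x} S → All (x <_) S → filter (survives? ℓ x) S ≡ S
survivors-above ℓ {x} S above =
  filter-all (survives? ℓ x) (All.map (λ x<y (_ , y≡x) → <⇒≢ x<y (sym y≡x)) above)

-- The child at the smallest site x: the other sites all lie above x, and x
-- itself is counted iff it survives, i.e. iff x ≤ ℓ.
childLabel-head-atMost : ∀ {ℓ x} S → All (x <_) S → x ≤ ℓ →
  childLabel ℓ (x ∷ S) x ≡ (suc (length S) , 1)
childLabel-head-atMost {ℓ} {x} S above x≤ℓ = begin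
  map₁ suc (labelAt x (filter (survives? ℓ x) (x ∷ S)))
    ≡⟨ cong (λ T → map₁ suc (labelAt x T)) (filter-accept (survives? ℓ x) (λ (ℓ<x , _) → ≤⇒≯ x≤ℓ ℓ<x)) ⟩
  map₁ suc (labelAt x (x ∷ filter (survives? ℓ x) S))
    ≡⟨ cong (λ T → map₁ suc (labelAt x (x ∷ T))) (survivors-above ℓ S above) ⟩
  map₁ suc (labelAt x (x ∷ S))
    ≡⟨ cong (map₁ suc) (labelAt-∷-atMost S ≤-refl) ⟩
  map₁ suc (map₂ suc (labelAt x S))
    ≡⟨ cong (λ p → map₁ suc (map₂ suc p)) (labelAt-allAbove S above) ⟩
  (suc (length S) , 1) ∎

childLabel-head-above : ∀ {ℓ x} S → All (x <_) S → ℓ < x →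
  childLabel ℓ (x ∷ S) x ≡ (suc (length S) , 0)
childLabel-head-above {ℓ} {x} S above ℓ<x = begin
  map₁ suc (labelAt x (filter (survives? ℓ x) (x ∷ S)))
    ≡⟨ cong (λ T → map₁ suc (labelAt x T)) (filter-reject (survives? ℓ x) (λ survives → survives (ℓ<x , refl))) ⟩
  map₁ suc (labelAt x (filter (survives? ℓ x) S))
    ≡⟨ cong (λ T → map₁ suc (labelAt x T)) (survivors-above ℓ S above) ⟩
  map₁ suc (labelAt x S)
    ≡⟨ cong (map₁ suc) (labelAt-allAbove S above) ⟩
  (suc (length S) , 0) ∎

aLabels : ℕ → ℕ → List (ℕ × ℕ)
aLabels c zero = []
aLabels c (suc a) = (suc a , c) ∷ aLabels (suc c) a

bLabels : ℕ → ℕ → ℕ → List (ℕ × ℕ)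
bLabels a k zero = []
bLabels a k (suc b) = (a + suc b , suc k) ∷ bLabels a (suc k) b

-- The labels of the children of a node with label (a , b), listed in the
-- increasing order of the active sites: first the b sites ≤ ℓ, then the a
-- sites above ℓ.
orderedLabels : ℕ × ℕ → List (ℕ × ℕ)
orderedLabels (a , b) = bLabels a 0 b ++ aLabels b a

aLabels-shift : ∀ c a → map (map₂ suc) (aLabels c a) ≡ aLabels (suc c) a
aLabels-shift c zero = refl
aLabels-shift c (suc a) = cong ((suc a , suc c) ∷_) (aLabels-shift (suc c) a)

bLabels-shift : ∀ a k b → map (map₂ suc) (bLabels a k b) ≡ bLabels a (suc k) b
bLabels-shift a k zero = refl
bLabels-shift a k (suc b) = cong ((a + suc b , suc (suc k)) ∷_) (bLabels-shift a (suc k) b)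

orderedLabels-shift : ∀ a b → map (map₂ suc) (orderedLabels (a , b)) ≡ bLabels a 1 b ++ aLabels (suc b) a
orderedLabels-shift a b = trans (map-++ (map₂ suc) (bLabels a 0 b) (aLabels b a))
  (cong₂ _++_ (bLabels-shift a 0 b) (aLabels-shift b a))

-- Removing the
-- smallest site x shifts the labels of all other children by (0, +1), and
-- the label of the child at x is computed directly.
childLabels-increasing : ∀ ℓ S → AllPairs _<_ S → map (childLabel ℓ S) S ≡ orderedLabels (labelAt ℓ S)
childLabels-increasing ℓ [] [] = refl
childLabels-increasing ℓ (x ∷ S) (x<S ∷ increasing) with <-≤-connex ℓ x
... | inj₁ ℓ<x = begin
  childLabel ℓ (x ∷ S) x ∷ map (childLabel ℓ (x ∷ S)) S
    ≡⟨ cong₂ _∷_ (childLabel-head-above S x<S ℓ<x) others ⟩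
  (suc (length S) , 0) ∷ map (map₂ suc) (orderedLabels (labelAt ℓ S))
    ≡⟨ cong (λ p → _ ∷ map (map₂ suc) (orderedLabels p)) (labelAt-allAbove S S-above-ℓ) ⟩
  (suc (length S) , 0) ∷ map (map₂ suc) (aLabels 0 (length S))
    ≡⟨ cong ((suc (length S) , 0) ∷_) (aLabels-shift 0 (length S)) ⟩
  orderedLabels (suc (length S) , 0)
    ≡⟨ cong orderedLabels (sym (labelAt-allAbove (x ∷ S) (ℓ<x ∷ S-above-ℓ))) ⟩
  orderedLabels (labelAt ℓ (x ∷ S)) ∎
  where
  S-above-ℓ : All (ℓ <_) S
  S-above-ℓ = All.map (<-trans ℓ<x) x<S
  others : map (childLabel ℓ (x ∷ S)) S ≡ map (map₂ suc) (orderedLabels (labelAt ℓ S))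
  others = trans (childLabels-∷-below ℓ S x<S) (cong (map (map₂ suc)) (childLabels-increasing ℓ S increasing))
... | inj₂ x≤ℓ = begin
  childLabel ℓ (x ∷ S) x ∷ map (childLabel ℓ (x ∷ S)) S
    ≡⟨ cong₂ _∷_ (childLabel-head-atMost S x<S x≤ℓ) others ⟩
  (suc (length S) , 1) ∷ map (map₂ suc) (orderedLabels (a , b))
    ≡⟨ cong₂ _∷_ (cong (_, 1) length≡) (orderedLabels-shift a b) ⟩
  (a + suc b , 1) ∷ bLabels a 1 b ++ aLabels (suc b) a
    ≡⟨ cong orderedLabels (sym (labelAt-∷-atMost S x≤ℓ)) ⟩
  orderedLabels (labelAt ℓ (x ∷ S)) ∎
  where
  a = proj₁ (labelAt ℓ S)
  b = proj₂ (labelAt ℓ S)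
  length≡ : suc (length S) ≡ a + suc b
  length≡ = trans (cong suc (sym (labelAt-total ℓ S))) (sym (+-suc a b))
  others : map (childLabel ℓ (x ∷ S)) S ≡ map (map₂ suc) (orderedLabels (a , b))
  others = trans (childLabels-∷-below ℓ S x<S) (cong (map (map₂ suc)) (childLabels-increasing ℓ S increasing))

applyUpTo-cong : ∀ {A : Set} {f g : ℕ → A} → (∀ i → f i ≡ g i) → ∀ n → applyUpTo f n ≡ applyUpTo g n
applyUpTo-cong {f = f} {g} f≗g n = begin
  applyUpTo f n    ≡⟨ map-upTo f n ⟨
  map f (upTo n)   ≡⟨ map-cong f≗g (upTo n) ⟩
  map g (upTo n)   ≡⟨ map-upTo g n ⟩
  applyUpTo g n    ∎

aLabels-applyUpTo : ∀ a c → applyUpTo (λ i → (a ∸ i , c + i)) a ≡ aLabels c a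
aLabels-applyUpTo zero c = refl
aLabels-applyUpTo (suc a) c = cong₂ _∷_ (cong (suc a ,_) (+-identityʳ c))
  (trans (applyUpTo-cong (λ i → cong (a ∸ i ,_) (+-suc c i)) a) (aLabels-applyUpTo a (suc c)))

bLabels-applyUpTo : ∀ a k b → applyUpTo (λ i → (a + b ∸ i , suc (k + i))) b ≡ bLabels a k b
bLabels-applyUpTo a k zero = refl
bLabels-applyUpTo a k (suc b) = cong₂ _∷_ (cong (a + suc b ,_) (cong suc (+-identityʳ k)))
  (trans (applyUpTo-cong (λ i → cong₂ _,_ (cong (_∸ suc i) (+-suc a b)) (cong suc (+-suc k i))) b)
         (bLabels-applyUpTo a (suc k) b))

successorLabels-blocks : ∀ a b → successorLabels (a , b) ≡ aLabels b a ++ bLabels a 0 b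
successorLabels-blocks a b = cong₂ _++_
  (trans (map-applyUpTo suc _ a)
    (trans (applyUpTo-cong (λ i → cong₂ _,_ (cong (_∸ suc i) (+-comm a 1)) (cong (_∸ 1) (+-suc b i))) a)
           (aLabels-applyUpTo a b)))
  (trans (map-applyUpTo suc _ b)
    (trans (applyUpTo-cong (λ i → cong (λ s → (s ∸ suc i , suc i)) (+-comm (a + b) 1)) b)
           (bLabels-applyUpTo a 0 b)))

orderedLabels↭successorLabels : ∀ p → orderedLabels p ↭ successorLabels p
orderedLabels↭successorLabels (a , b) =
  ↭-trans (++-comm (bLabels a 0 b) (aLabels b a)) (↭-reflexive (sym (successorLabels-blocks a b)))

filter-conj : ∀ {A : Set} {P Q R C : Pred A 0ℓ} (P? : Decidable P) (Q? : Decidable Q) (R? : Decidable R) →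
  (∀ {y} → C y → P y → Q y × R y) → (∀ {y} → C y → Q y → R y → P y) →
  ∀ {xs} → All C xs → filter P? xs ≡ filter R? (filter Q? xs)
filter-conj P? Q? R? to from [] = refl
filter-conj P? Q? R? to from {y ∷ xs} (c ∷ cs) with Q? y
... | no ¬q = trans (filter-reject P? (¬q ∘ proj₁ ∘ to c)) (filter-conj P? Q? R? to from cs)
... | yes q with R? y
...   | yes r = trans (filter-accept P? (from c q r)) (cong (y ∷_) (filter-conj P? Q? R? to from cs))
...   | no ¬r = trans (filter-reject P? (¬r ∘ proj₂ ∘ to c)) (filter-conj P? Q? R? to from cs)

lookup-∷ʳ-inject₁ : ∀ {A : Set} {m} (v : Vec A m) y (i : Fin m) → lookup (v ∷ʳ y) (inject₁ i) ≡ lookup v i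
lookup-∷ʳ-inject₁ (x ∷ v) y fzero = refl
lookup-∷ʳ-inject₁ (x ∷ v) y (fsuc i) = lookup-∷ʳ-inject₁ v y i

lookup-∷ʳ-fromℕ : ∀ {A : Set} {m} (v : Vec A m) y → lookup (v ∷ʳ y) (fromℕ m) ≡ y
lookup-∷ʳ-fromℕ [] y = refl
lookup-∷ʳ-fromℕ (x ∷ v) y = lookup-∷ʳ-fromℕ v y

lastOr0-∷ʳ : ∀ {m} (v : Vec ℕ m) h → lastOr0 (v ∷ʳ h) ≡ h
lastOr0-∷ʳ [] h = refl
lastOr0-∷ʳ (x ∷ []) h = refl
lastOr0-∷ʳ (x ∷ y ∷ v) h = lastOr0-∷ʳ (y ∷ v) h

lookup-last : ∀ {m} (v : Vec ℕ m) (i : Fin m) → suc (toℕ i) ≡ m → lookup v i ≡ lastOr0 v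
lookup-last (x ∷ []) fzero _ = refl
lookup-last (x ∷ y ∷ v) (fsuc i) i-last = lookup-last (y ∷ v) i (suc-injective i-last)

inject₁-next : ∀ {m} {i j : Fin m} → toℕ j ≡ suc (toℕ i) → toℕ (inject₁ j) ≡ suc (toℕ (inject₁ i))
inject₁-next {i = i} {j} next rewrite toℕ-inject₁ i | toℕ-inject₁ j = next

inject₁-next⁻ : ∀ {m} {i j : Fin m} → toℕ (inject₁ j) ≡ suc (toℕ (inject₁ i)) → toℕ j ≡ suc (toℕ i)
inject₁-next⁻ {i = i} {j} next rewrite toℕ-inject₁ i | toℕ-inject₁ j = next

fromℕ-no-next : ∀ {m} (j : Fin (suc m)) → toℕ j ≢ suc (toℕ (fromℕ m))
fromℕ-no-next {m} j next = <-irrefl (trans next (cong suc (toℕ-fromℕ m))) (toℕ<n j)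

fromℕ-maximal : ∀ {m} (k : Fin (suc m)) → ¬ toℕ (fromℕ m) < toℕ k
fromℕ-maximal {m} k beyond = <⇒≱ beyond (subst (toℕ k ≤_) (sym (toℕ-fromℕ m)) (s≤s⁻¹ (toℕ<n k)))

Ascent : ∀ {m} → Vec ℕ m → Fin m → Fin m → Set
Ascent v i j = (toℕ j ≡ suc (toℕ i)) × (lookup v i < lookup v j)

-- y is the top v_j of an ascent of v.  An occurrence of 01̲1 in v ∷ʳ y
-- ending at the new entry is exactly an ascent of v with top y, so these
-- are the values that are not active sites.
AscentTop : ∀ {m} → Vec ℕ m → ℕ → Set
AscentTop {m} v y = Σ (Fin m) λ i → Σ (Fin m) λ j → Ascent v i j × (lookup v j ≡ y)

ascent-inject₁ : ∀ {m} (v : Vec ℕ m) y {i j} → Ascent v i j → Ascent (v ∷ʳ y) (inject₁ i) (inject₁ j)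
ascent-inject₁ v y {i} {j} (next , up) =
  inject₁-next next , subst₂ _<_ (sym (lookup-∷ʳ-inject₁ v y i)) (sym (lookup-∷ʳ-inject₁ v y j)) up

data AscentView {m} (v : Vec ℕ m) (y : ℕ) : Fin (suc m) → Fin (suc m) → Set where
  old : ∀ {i j} → Ascent v i j → AscentView v y (inject₁ i) (inject₁ j)
  new : ∀ {i} → lastOr0 v < y → AscentView v y (inject₁ i) (fromℕ m)

ascent-∷ʳ : ∀ {m} (v : Vec ℕ m) y {i j} → Ascent (v ∷ʳ y) i j → AscentView v y i j
ascent-∷ʳ {m} v y {i} {j} (next , up) with view i | view j
... | ‵fromℕ | _ = ⊥-elim (fromℕ-no-next j next)
... | ‵inject₁ i′ | ‵inject₁ j′ =
  old (inject₁-next⁻ next , subst₂ _<_ (lookup-∷ʳ-inject₁ v y i′) (lookup-∷ʳ-inject₁ v y j′) up)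
... | ‵inject₁ i′ | ‵fromℕ =
  new (subst₂ _<_ (trans (lookup-∷ʳ-inject₁ v y i′) (lookup-last v i′ i′-last)) (lookup-∷ʳ-fromℕ v y) up)
  where
  i′-last : suc (toℕ i′) ≡ m
  i′-last = trans (cong suc (sym (toℕ-inject₁ i′))) (trans (sym next) (toℕ-fromℕ m))

ascentTop-inject₁ : ∀ {m} (v : Vec ℕ m) h {y} → AscentTop v y → AscentTop (v ∷ʳ h) y
ascentTop-inject₁ v h (i , j , asc , top) =
  inject₁ i , inject₁ j , ascent-inject₁ v h asc , trans (lookup-∷ʳ-inject₁ v h j) top

ascentTop-∷ʳ : ∀ {m} (v : Vec ℕ m) h {y} → AscentTop (v ∷ʳ h) y → AscentTop v y ⊎ (lastOr0 v < h × y ≡ h)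
ascentTop-∷ʳ v h (i , j , asc , top) with ascent-∷ʳ v h asc
... | old {j = j′} asc′ = inj₁ (_ , j′ , asc′ , trans (sym (lookup-∷ʳ-inject₁ v h j′)) top)
... | new ℓ<h = inj₂ (ℓ<h , trans (sym top) (lookup-∷ʳ-fromℕ v h))

-- ... and it does add h in that case (the bound h ≤ m excludes v = []).
ascentTop-new : ∀ {m} (v : Vec ℕ m) h → h ≤ m → lastOr0 v < h → AscentTop (v ∷ʳ h) h
ascentTop-new [] h h≤0 0<h = ⊥-elim (<⇒≱ 0<h h≤0)
ascentTop-new {suc m} v h _ ℓ<h = inject₁ (fromℕ m) , fromℕ (suc m) , (next , up) , lookup-∷ʳ-fromℕ v h
  where
  next : toℕ (fromℕ (suc m)) ≡ suc (toℕ (inject₁ (fromℕ m)))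
  next = trans (toℕ-fromℕ (suc m)) (cong suc (sym (trans (toℕ-inject₁ (fromℕ m)) (toℕ-fromℕ m))))
  up : lookup (v ∷ʳ h) (inject₁ (fromℕ m)) < lookup (v ∷ʳ h) (fromℕ (suc m))
  up = subst₂ _<_
    (sym (trans (lookup-∷ʳ-inject₁ v h (fromℕ m)) (lookup-last v (fromℕ m) (cong suc (toℕ-fromℕ m)))))
    (sym (lookup-∷ʳ-fromℕ v h)) ℓ<h

occ011-∷ʳ : ∀ {m} (v : Vec ℕ m) y → Occ011 (v ∷ʳ y) → Occ011 v ⊎ AscentTop v y
occ011-∷ʳ v y (i , j , k , next , j<k , up , j≡k) with ascent-∷ʳ v y (next , up) | view k
... | new _ | _ = ⊥-elim (fromℕ-maximal k j<k)
... | old {i′} {j′} (next′ , up′) | ‵inject₁ k′ =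
  inj₁ (i′ , j′ , k′ , next′ , subst₂ _<_ (toℕ-inject₁ j′) (toℕ-inject₁ k′) j<k , up′ ,
        trans (sym (lookup-∷ʳ-inject₁ v y j′)) (trans j≡k (lookup-∷ʳ-inject₁ v y k′)))
... | old {i′} {j′} asc | ‵fromℕ =
  inj₂ (i′ , j′ , asc , trans (sym (lookup-∷ʳ-inject₁ v y j′)) (trans j≡k (lookup-∷ʳ-fromℕ v y)))

ascentTop-occ011 : ∀ {m} (v : Vec ℕ m) y → AscentTop v y → Occ011 (v ∷ʳ y)
ascentTop-occ011 {m} v y (i , j , asc , top) =
  inject₁ i , inject₁ j , fromℕ m , next , j<last , up ,
  trans (lookup-∷ʳ-inject₁ v y j) (trans top (sym (lookup-∷ʳ-fromℕ v y)))
  where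
  next = proj₁ (ascent-inject₁ v y asc)
  up = proj₂ (ascent-inject₁ v y asc)
  j<last : toℕ (inject₁ j) < toℕ (fromℕ m)
  j<last = subst (toℕ (inject₁ j) <_) (sym (toℕ-fromℕ m)) (inject₁ℕ< j)

isInv-∷ʳ : ∀ {m} (v : Vec ℕ m) y → IsInv v → y ≤ m → IsInv (v ∷ʳ y)
isInv-∷ʳ {m} v y inv y≤m k with view k
... | ‵inject₁ i = subst₂ _<_ (sym (lookup-∷ʳ-inject₁ v y i)) (cong suc (sym (toℕ-inject₁ i))) (inv i)
... | ‵fromℕ = subst₂ _<_ (sym (lookup-∷ʳ-fromℕ v y)) (cong suc (sym (toℕ-fromℕ m))) (s≤s y≤m)

ascentTop-bound : ∀ {m} (v : Vec ℕ m) {y} → IsInv v → AscentTop v y → y < m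
ascentTop-bound v inv (_ , j , _ , top) = subst (_< _) top (≤-<-trans (s≤s⁻¹ (inv j)) (toℕ<n j))

active⇒noAscentTop : ∀ {m} (v : Vec ℕ m) {y} → IsActive v y → ¬ AscentTop v y
active⇒noAscentTop v {y} (_ , _ , noOcc) top = noOcc (ascentTop-occ011 v y top)

noAscentTop⇒active : ∀ {m} (v : Vec ℕ m) {y} → InI011 v → y ≤ m → ¬ AscentTop v y → IsActive v y
noAscentTop⇒active v {y} (inv , noOcc) y≤m noTop =
  y≤m , isInv-∷ʳ v y inv y≤m , [ noOcc , noTop ]′ ∘ occ011-∷ʳ v y

length-active : ∀ {m} (v : Vec ℕ m) → InI011 v → IsActive v m
length-active v v∈I = noAscentTop⇒active v v∈I ≤-refl
  (λ top → <-irrefl refl (ascentTop-bound v (proj₁ v∈I) top))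

activeSites-increasing : ∀ {m} (v : Vec ℕ m) → AllPairs _<_ (activeSites v)
activeSites-increasing {m} v = AllPairs.filter⁺ (isActive? v) (AllPairs.applyUpTo⁺₁ id (suc m) (λ i<j _ → i<j))

module Child {n} (e : Vec ℕ n) (e∈I : InI011 e) {h} (h-active : IsActive e h) where

  active-∷ʳ⇒ : ∀ {y} → y < suc n → IsActive (e ∷ʳ h) y → IsActive e y × Survives (lastOr0 e) h y
  active-∷ʳ⇒ y≤n y-active =
    noAscentTop⇒active e e∈I (s≤s⁻¹ y≤n) (noTop ∘ ascentTop-inject₁ e h) ,
    λ { (ℓ<h , refl) → noTop (ascentTop-new e h (proj₁ h-active) ℓ<h) }
    where noTop = active⇒noAscentTop (e ∷ʳ h) y-active

  active-∷ʳ⇐ : ∀ {y} → y < suc n → IsActive e y → Survives (lastOr0 e) h y → IsActive (e ∷ʳ h) y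
  active-∷ʳ⇐ y≤n y-active survives = noAscentTop⇒active (e ∷ʳ h) (proj₂ h-active) (m≤n⇒m≤1+n (s≤s⁻¹ y≤n))
    (λ top → [ active⇒noAscentTop e y-active , survives ]′ (ascentTop-∷ʳ e h top))

  activeSites-∷ʳ : activeSites (e ∷ʳ h) ≡ filter (survives? (lastOr0 e) h) (activeSites e) ++ [ suc n ]
  activeSites-∷ʳ = begin
    filter (isActive? (e ∷ʳ h)) (upTo (suc (suc n)))
      ≡⟨ cong (filter (isActive? (e ∷ʳ h))) (upTo-∷ʳ (suc n)) ⟨
    filter (isActive? (e ∷ʳ h)) (upTo (suc n) ++ [ suc n ])
      ≡⟨ filter-++ (isActive? (e ∷ʳ h)) (upTo (suc n)) [ suc n ] ⟩
    filter (isActive? (e ∷ʳ h)) (upTo (suc n)) ++ filter (isActive? (e ∷ʳ h)) [ suc n ]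
      ≡⟨ cong₂ _++_
           (filter-conj (isActive? (e ∷ʳ h)) (isActive? e) (survives? (lastOr0 e) h) active-∷ʳ⇒ active-∷ʳ⇐
              (applyUpTo⁺₁ id (suc n) id))
           (filter-accept (isActive? (e ∷ʳ h)) (length-active (e ∷ʳ h) (proj₂ h-active))) ⟩
    filter (survives? (lastOr0 e) h) (activeSites e) ++ [ suc n ] ∎

  label-∷ʳ : label (e ∷ʳ h) ≡ childLabel (lastOr0 e) (activeSites e) h
  label-∷ʳ = begin
    labelAt (lastOr0 (e ∷ʳ h)) (activeSites (e ∷ʳ h))
      ≡⟨ cong₂ labelAt (lastOr0-∷ʳ e h) activeSites-∷ʳ ⟩
    labelAt h (filter (survives? (lastOr0 e) h) (activeSites e) ++ [ suc n ])
      ≡⟨ labelAt-∷ʳ-above (filter (survives? (lastOr0 e) h) (activeSites e)) (s≤s (proj₁ h-active)) ⟩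
    childLabel (lastOr0 e) (activeSites e) h ∎

childLabels-ordered : ∀ n (e : Vec ℕ n) → InI011 e → childLabels e ≡ orderedLabels (label e)
childLabels-ordered n e e∈I = begin
  map (λ h → label (e ∷ʳ h)) (activeSites e)
    ≡⟨ map-cong-local (All.map (Child.label-∷ʳ e e∈I) (all-filter (isActive? e) (upTo (suc n)))) ⟩
  map (childLabel (lastOr0 e) (activeSites e)) (activeSites e)
    ≡⟨ childLabels-increasing (lastOr0 e) (activeSites e) (activeSites-increasing e) ⟩
  orderedLabels (label e) ∎

proposition3p14 : (label {0} [] ≡ (0 , 1)) ×
    ((n : ℕ) (e : Vec ℕ n) → InI011 e → childLabels e ↭ successorLabels (label e))
proposition3p14 = refl , λ n e e∈I →
  ↭-trans (↭-reflexive (childLabels-ordered n e e∈I)) (orderedLabels↭successorLabels (label e))
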